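{- Let $d,n$ be integers with $d\geq1$ and $n\geq1$. Then $\mathrm{gp}^2_d(P_n\,\Box\,P_2)=\lceil n/d\rceil$.
   Context: $P_n\,\Box\,P_2$ is the grid with vertex set $\{1,\ldots,n\}\times\{1,2\}$, where $(i,j)$ and $(i',j')$ are adjacent iff either $j=j'$ and $|i-i'|=1$, or $i=i'$ and $j\neq j'$. For a graph $G$, a geodesic is a shortest path between two vertices; its length $\lambda(g)$ is its number of edges. For $d\ge1$, $k\ge2$, $S\subseteq V(G)$ is a $k$-general $d$-position set if every geodesic $g$ with $|S\cap V(g)|\geq k$ has $\lambda(g)>d$; $\mathrm{gp}^k_d(G)$ is the largest cardinality of such a set. -}

module Defs where

open import Data.Nat using (ℕ; zero; suc; _+_; _∸_; _≤_; _<_; NonZero)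
open import Data.Nat.DivMod using (_/_)
open import Data.Fin using (Fin; toℕ)
open import Data.Fin.Properties using () renaming (_≟_ to _≟ᶠ_)
open import Data.Product using (_×_; _,_; Σ-syntax)
open import Data.Product.Properties using (≡-dec)
open import Data.Sum using (_⊎_)
open import Data.List using (List; []; _∷_; length; filter)
open import Data.List.Relation.Unary.Unique.Propositional using (Unique)
open import Data.List.Membership.DecPropositional using ()
open import Relation.Binary.PropositionalEquality using (_≡_; _≢_)
open import Relation.Binary.Definitions using (DecidableEquality)
import Data.List.Membership.DecPropositional as DecMem

record Graph : Set₁ where
  field
    V    : Set
    _≟V_ : DecidableEquality V
    Adj  : V → V → Set

module _ (G : Graph) where
  open Graph G

  data Walk : V → V → Set where
    []  : ∀ {u} → Walk u u
    _∷_ : ∀ {u v w} → Adj u v → Walk v w → Walk u w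

  len : ∀ {u v} → Walk u v → ℕ
  len []      = 0
  len (_ ∷ p) = suc (len p)

  verts : ∀ {u v} → Walk u v → List V
  verts {u} []        = u ∷ []
  verts {u} (_ ∷ p)   = u ∷ verts p

  IsGeodesic : ∀ {u v} → Walk u v → Set
  IsGeodesic {u} {v} p = (q : Walk u v) → len p ≤ len q

  -- |S ∩ V(g)| for S given as a duplicate-free list
  countIn : List V → ∀ {u v} → Walk u v → ℕ
  countIn S g = length (filter (λ x → x ∈? verts g) S)
    where open DecMem _≟V_ using (_∈?_)

  IsGenPos : ℕ → ℕ → List V → Set
  IsGenPos k d S = ∀ {u v} (g : Walk u v) → IsGeodesic g → k ≤ countIn S g → d < len g

  GpEq : ℕ → ℕ → ℕ → Set
  GpEq k d m =
    (Σ[ S ∈ List V ] (Unique S × IsGenPos k d S × length S ≡ m))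
    × (∀ (S : List V) → Unique S → IsGenPos k d S → length S ≤ m)

-- P_n □ P_2 with vertex set Fin n × Fin 2 (i.e. {1..n} × {1,2}, shifted)
GridAdj : (n : ℕ) → Fin n × Fin 2 → Fin n × Fin 2 → Set
GridAdj n (i , j) (i' , j') =
  (j ≡ j' × (suc (toℕ i) ≡ toℕ i' ⊎ suc (toℕ i') ≡ toℕ i))
  ⊎ (i ≡ i' × j ≢ j')

PnP2 : ℕ → Graph
PnP2 n = record { V = Fin n × Fin 2 ; _≟V_ = ≡-dec _≟ᶠ_ _≟ᶠ_ ; Adj = GridAdj n }

⌈_/_⌉ : ℕ → (d : ℕ) → .{{NonZero d}} → ℕ
⌈ n / d ⌉ = (n + d ∸ 1) / d

-- A set is in 2-general d-position iff its points are pairwise more than d apart: a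
-- geodesic through two of its points is at least as long as their distance, and a
-- shortest path between them is such a geodesic.  In P_n □ P_2 the distance is the
-- Manhattan distance ∣i - i'∣ + ∣j - j'∣.  Cutting the n columns into ⌈n/d⌉ blocks of
-- d consecutive columns, two vertices of one block are at distance at most
-- (d - 1) + 1 = d, so the set meets each block at most once.  Conversely the staircase
-- (d k, k mod 2), 0 ≤ d k < n, has consecutive points at distance d + 1 and all other
-- pairs at distance at least 2d.
module Submission where

open import Defs
open import Data.Nat using (ℕ; zero; suc; _+_; _*_; _≤_; _<_; z≤n; s≤s; z<s; ∣_-_∣; _⊔_; NonZero)
open import Data.Nat.Properties
open import Data.Nat.DivMod using (_/_; _%_; m≡m%n+[m/n]*n; m%n<n; m/n*n≤m; /-monoˡ-≤; +-distrib-/-∣ʳ; n/n≡1)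
open import Data.Nat.Divisibility using (∣-refl)
open import Algebra.Properties.CommutativeSemigroup +-commutativeSemigroup using (interchange)
open import Data.Fin using (Fin; toℕ; fromℕ<) renaming (zero to fzero; suc to fsuc)
open import Data.Fin.Properties using (toℕ-fromℕ<; toℕ-injective; toℕ<n; injective⇒≤) renaming (_≟_ to _≟ᶠ_)
open import Data.Product using (Σ-syntax; _×_; _,_)
open import Data.Sum using (_⊎_; inj₁; inj₂) renaming (swap to ⊎-swap)
open import Data.List using (List; []; _∷_; length; filter; lookup; tabulate)
open import Data.List.Properties using (length-tabulate)
open import Data.List.Relation.Unary.All using (All; []; _∷_)
import Data.List.Relation.Unary.All as All
open import Data.List.Relation.Unary.All.Properties using (all-filter)
open import Data.List.Relation.Unary.AllPairs using (AllPairs; []; _∷_)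
import Data.List.Relation.Unary.AllPairs as AllPairs
import Data.List.Relation.Unary.AllPairs.Properties as AllPairs
open import Data.List.Relation.Unary.Any using (here; there)
open import Data.List.Relation.Unary.Unique.Propositional using (Unique)
open import Data.List.Membership.Propositional using (_∈_)
open import Data.List.Membership.Propositional.Properties using (∈-filter⁺; ∈-lookup)
import Data.List.Membership.DecPropositional as DecMembership
open import Function using (_∘_; Injective)
open import Relation.Binary.PropositionalEquality
open import Relation.Nullary using (yes; no; contradiction)

module _ {A : Set} where

  distinct-∈⇒2≤length : ∀ {x y : A} {xs} → x ∈ xs → y ∈ xs → x ≢ y → 2 ≤ length xs
  distinct-∈⇒2≤length {xs = _ ∷ _ ∷ _} _          _          _   = s≤s (s≤s z≤n)
  distinct-∈⇒2≤length                  (here refl) (here refl) x≢y = contradiction refl x≢y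

  AllPairs-mapWith∈ : ∀ {R S : A → A → Set} {xs} → (∀ {x y} → x ∈ xs → y ∈ xs → R x y → S x y) →
                      AllPairs R xs → AllPairs S xs
  AllPairs-mapWith∈ f []          = []
  AllPairs-mapWith∈ f (Rx ∷ Rxs) =
    All.tabulate (λ y∈ → f (here refl) (there y∈) (All.lookup Rx y∈)) ∷
    AllPairs-mapWith∈ (λ x∈ y∈ → f (there x∈) (there y∈)) Rxs

  module _ {m} (f : A → Fin m) where

    lookup-injective : ∀ {xs} → AllPairs (λ x y → f x ≢ f y) xs → Injective _≡_ _≡_ (f ∘ lookup xs)
    lookup-injective (_   ∷ _)   {fzero}  {fzero}  _  = refl
    lookup-injective (fx≢ ∷ _)   {fzero}  {fsuc j} eq = contradiction eq (All.lookup fx≢ (∈-lookup j))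
    lookup-injective (fx≢ ∷ _)   {fsuc i} {fzero}  eq = contradiction (sym eq) (All.lookup fx≢ (∈-lookup i))
    lookup-injective (_   ∷ fxs) {fsuc i} {fsuc j} eq = cong fsuc (lookup-injective fxs eq)

    length≤-if-separated-by : ∀ {xs} → AllPairs (λ x y → f x ≢ f y) xs → length xs ≤ m
    length≤-if-separated-by sep = injective⇒≤ (lookup-injective sep)

∣m-1+m∣≡1 : ∀ m → ∣ m - suc m ∣ ≡ 1
∣m-1+m∣≡1 zero    = refl
∣m-1+m∣≡1 (suc m) = ∣m-1+m∣≡1 m

adjacent⇒∣m-n∣≡1 : ∀ {m n} → suc m ≡ n ⊎ suc n ≡ m → ∣ m - n ∣ ≡ 1
adjacent⇒∣m-n∣≡1 {m}     (inj₁ refl) = ∣m-1+m∣≡1 m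
adjacent⇒∣m-n∣≡1 {n = n} (inj₂ refl) = trans (∣-∣-comm (suc n) n) (∣m-1+m∣≡1 n)

m/o≡n/o⇒∣m-n∣<o : ∀ {m n o} .{{_ : NonZero o}} → m / o ≡ n / o → ∣ m - n ∣ < o
m/o≡n/o⇒∣m-n∣<o {m} {n} {o} eq = begin-strict
  ∣ m - n ∣                                     ≡⟨ cong₂ ∣_-_∣ (m≡m%n+[m/n]*n m o) (m≡m%n+[m/n]*n n o) ⟩
  ∣ m % o + m / o * o - n % o + n / o * o ∣     ≡⟨ cong (λ q → ∣ m % o + m / o * o - n % o + q * o ∣) (sym eq) ⟩
  ∣ m % o + m / o * o - n % o + m / o * o ∣     ≡⟨ cong₂ ∣_-_∣ (+-comm (m % o) _) (+-comm (n % o) _) ⟩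
  ∣ m / o * o + m % o - m / o * o + n % o ∣     ≡⟨ ∣m+n-m+o∣≡∣n-o∣ (m / o * o) (m % o) (n % o) ⟩
  ∣ m % o - n % o ∣                             ≤⟨ ∣m-n∣≤m⊔n (m % o) (n % o) ⟩
  m % o ⊔ n % o                                 <⟨ ⊔-lub (m%n<n m o) (m%n<n n o) ⟩
  o                                             ∎
  where open ≤-Reasoning

module _ (G : Graph) where
  open Graph G

  module _ (Adj-sym : ∀ {x y} → Adj x y → Adj y x) where

    reverse-onto : ∀ {u v w} → Walk G v u → Walk G v w → Walk G u w
    reverse-onto []      q = q
    reverse-onto (e ∷ p) q = reverse-onto p (Adj-sym e ∷ q)

    len-reverse-onto : ∀ {u v w} (p : Walk G v u) (q : Walk G v w) →
                       len G (reverse-onto p q) ≡ len G p + len G q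
    len-reverse-onto []      q = refl
    len-reverse-onto (e ∷ p) q = trans (len-reverse-onto p (Adj-sym e ∷ q)) (+-suc (len G p) (len G q))

    reverse : ∀ {u v} → Walk G u v → Walk G v u
    reverse p = reverse-onto p []

    len-reverse : ∀ {u v} (p : Walk G u v) → len G (reverse p) ≡ len G p
    len-reverse p = trans (len-reverse-onto p []) (+-identityʳ (len G p))

  record IsGraphDistance (dist : V → V → ℕ) : Set where
    field
      dist-refl     : ∀ x → dist x x ≡ 0
      dist-sym      : ∀ x y → dist x y ≡ dist y x
      dist-triangle : ∀ x y z → dist x z ≤ dist x y + dist y z
      dist-adj      : ∀ {x y} → Adj x y → dist x y ≤ 1
      shortestWalk  : ∀ x y → Σ[ p ∈ Walk G x y ] len G p ≡ dist x y

  module GraphDistance {dist : V → V → ℕ} (isDist : IsGraphDistance dist) where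
    open IsGraphDistance isDist
    open DecMembership _≟V_ using (_∈?_)

    dist-from-start≤len : ∀ {u v} (p : Walk G u v) {y} → y ∈ verts G p → dist u y ≤ len G p
    dist-from-start≤len {u} []      (here refl) = ≤-reflexive (dist-refl u)
    dist-from-start≤len {u} (e ∷ p) (here refl) = ≤-trans (≤-reflexive (dist-refl u)) z≤n
    dist-from-start≤len {u} (_∷_ {v = v} e p) {y} (there y∈) = begin
      dist u y             ≤⟨ dist-triangle u v y ⟩
      dist u v + dist v y  ≤⟨ +-mono-≤ (dist-adj e) (dist-from-start≤len p y∈) ⟩
      suc (len G p)        ∎
      where open ≤-Reasoning

    dist≤len : ∀ {u v} (p : Walk G u v) {x y} → x ∈ verts G p → y ∈ verts G p → dist x y ≤ len G p
    dist≤len []      (here refl) y∈          = dist-from-start≤len [] y∈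
    dist≤len (e ∷ p) (here refl) y∈          = dist-from-start≤len (e ∷ p) y∈
    dist≤len (e ∷ p) {x} {y} (there x∈) (here refl) =
      subst (_≤ len G (e ∷ p)) (dist-sym y x) (dist-from-start≤len (e ∷ p) (there x∈))
    dist≤len (e ∷ p) (there x∈) (there y∈)   = m≤n⇒m≤1+n (dist≤len p x∈ y∈)

    start∈verts : ∀ {u v} (p : Walk G u v) → u ∈ verts G p
    start∈verts []      = here refl
    start∈verts (e ∷ p) = here refl

    end∈verts : ∀ {u v} (p : Walk G u v) → v ∈ verts G p
    end∈verts []      = here refl
    end∈verts (e ∷ p) = there (end∈verts p)

    len≡dist⇒isGeodesic : ∀ {x y} (p : Walk G x y) → len G p ≡ dist x y → IsGeodesic G p
    len≡dist⇒isGeodesic p |p|≡dist q = subst (_≤ len G q) (sym |p|≡dist) (dist-from-start≤len q (end∈verts q))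

    Separated : ℕ → List V → Set
    Separated d = AllPairs (λ x y → d < dist x y)

    separated⇒unique : ∀ {d S} → Separated d S → Unique S
    separated⇒unique {d} = AllPairs.map λ {x} d<dist → λ { refl → n≮0 (subst (d <_) (dist-refl x) d<dist) }

    separated⇒genPos : ∀ {d S} → Separated d S → IsGenPos G 2 d S
    separated⇒genPos {d} {S} sep g _ 2≤count =
      closePair (filter (_∈? verts G g) S) 2≤count (AllPairs.filter⁺ (_∈? verts G g) sep) (all-filter (_∈? verts G g) S)
      where
      closePair : ∀ F → 2 ≤ length F → Separated d F → All (_∈ verts G g) F → d < len G g
      closePair (_ ∷ [])    (s≤s ()) _                  _
      closePair (x ∷ y ∷ _) _        ((d<dist ∷ _) ∷ _) (x∈ ∷ y∈ ∷ _) = <-≤-trans d<dist (dist≤len g x∈ y∈)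

    genPos⇒separated : ∀ {d S} → Unique S → IsGenPos G 2 d S → Separated d S
    genPos⇒separated {d} {S} unique genPos = AllPairs-mapWith∈ far unique
      where
      far : ∀ {x y} → x ∈ S → y ∈ S → x ≢ y → d < dist x y
      far {x} {y} x∈S y∈S x≢y with shortestWalk x y
      ... | p , |p|≡dist = subst (d <_) |p|≡dist (genPos p (len≡dist⇒isGeodesic p |p|≡dist)
        (distinct-∈⇒2≤length (∈-filter⁺ (_∈? verts G p) x∈S (start∈verts p))
                             (∈-filter⁺ (_∈? verts G p) y∈S (end∈verts p)) x≢y))

∣j-j′∣≤1 : (j j′ : Fin 2) → ∣ toℕ j - toℕ j′ ∣ ≤ 1
∣j-j′∣≤1 fzero        fzero        = z≤n
∣j-j′∣≤1 fzero        (fsuc fzero) = ≤-refl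
∣j-j′∣≤1 (fsuc fzero) fzero        = ≤-refl
∣j-j′∣≤1 (fsuc fzero) (fsuc fzero) = z≤n

j≢j′⇒∣j-j′∣≡1 : {j j′ : Fin 2} → j ≢ j′ → ∣ toℕ j - toℕ j′ ∣ ≡ 1
j≢j′⇒∣j-j′∣≡1 {fzero}      {fzero}      j≢j′ = contradiction refl j≢j′
j≢j′⇒∣j-j′∣≡1 {fzero}      {fsuc fzero} _    = refl
j≢j′⇒∣j-j′∣≡1 {fsuc fzero} {fzero}      _    = refl
j≢j′⇒∣j-j′∣≡1 {fsuc fzero} {fsuc fzero} j≢j′ = contradiction refl j≢j′

module Grid {n : ℕ} where

  Vertex : Set
  Vertex = Fin n × Fin 2

  gridDist : Vertex → Vertex → ℕ
  gridDist (i , j) (i′ , j′) = ∣ toℕ i - toℕ i′ ∣ + ∣ toℕ j - toℕ j′ ∣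

  gridAdj-sym : ∀ {x y} → GridAdj n x y → GridAdj n y x
  gridAdj-sym (inj₁ (refl , i~i′)) = inj₁ (refl , ⊎-swap i~i′)
  gridAdj-sym (inj₂ (refl , j≢j′)) = inj₂ (refl , j≢j′ ∘ sym)

  gridDist-adj : ∀ {x y} → GridAdj n x y → gridDist x y ≤ 1
  gridDist-adj {i , j} {i′ , _} (inj₁ (refl , i~i′)) =
    ≤-reflexive (cong₂ _+_ (adjacent⇒∣m-n∣≡1 i~i′) (∣n-n∣≡0 (toℕ j)))
  gridDist-adj {i , j} {_ , j′} (inj₂ (refl , _)) =
    subst (_≤ 1) (cong (_+ ∣ toℕ j - toℕ j′ ∣) (sym (∣n-n∣≡0 (toℕ i)))) (∣j-j′∣≤1 j j′)

  gridDist-triangle : ∀ x y z → gridDist x z ≤ gridDist x y + gridDist y z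
  gridDist-triangle (a , ja) (b , jb) (c , jc) =
    ≤-trans (+-mono-≤ (∣-∣-triangle (toℕ a) (toℕ b) (toℕ c)) (∣-∣-triangle (toℕ ja) (toℕ jb) (toℕ jc)))
            (≤-reflexive (interchange ∣ toℕ a - toℕ b ∣ ∣ toℕ b - toℕ c ∣ ∣ toℕ ja - toℕ jb ∣ ∣ toℕ jb - toℕ jc ∣))

  rightwardWalk : ∀ k {i i′ : Fin n} j → toℕ i + k ≡ toℕ i′ →
                  Σ[ p ∈ Walk (PnP2 n) (i , j) (i′ , j) ] len (PnP2 n) p ≡ k
  rightwardWalk zero {i} j i+0≡i′ with toℕ-injective (trans (sym (+-identityʳ (toℕ i))) i+0≡i′)
  ... | refl = [] , refl
  rightwardWalk (suc k) {i} {i′} j i+k+1≡i′ =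
    let p , |p|≡k = rightwardWalk k j (trans (cong (_+ k) (toℕ-fromℕ< i+1<n)) i+1+k≡i′)
    in  inj₁ (refl , inj₁ (sym (toℕ-fromℕ< i+1<n))) ∷ p , cong suc |p|≡k
    where
    i+1+k≡i′ : suc (toℕ i) + k ≡ toℕ i′
    i+1+k≡i′ = trans (sym (+-suc (toℕ i) k)) i+k+1≡i′
    i+1<n : suc (toℕ i) < n
    i+1<n = ≤-<-trans (subst (suc (toℕ i) ≤_) i+1+k≡i′ (m≤m+n (suc (toℕ i)) k)) (toℕ<n i′)

  rowWalk : ∀ j (i i′ : Fin n) → Σ[ p ∈ Walk (PnP2 n) (i , j) (i′ , j) ] len (PnP2 n) p ≡ ∣ toℕ i - toℕ i′ ∣
  rowWalk j i i′ with ≤-total (toℕ i) (toℕ i′)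
  ... | inj₁ i≤i′ = let p , |p| = rightwardWalk _ j (m+[n∸m]≡n i≤i′)
                    in  p , trans |p| (sym (m≤n⇒∣m-n∣≡n∸m i≤i′))
  ... | inj₂ i′≤i = let p , |p| = rightwardWalk _ j (m+[n∸m]≡n i′≤i)
                    in  reverse (PnP2 n) gridAdj-sym p ,
                        trans (len-reverse (PnP2 n) gridAdj-sym p) (trans |p| (sym (m≤n⇒∣n-m∣≡n∸m i′≤i)))

  gridWalk : ∀ x y → Σ[ p ∈ Walk (PnP2 n) x y ] len (PnP2 n) p ≡ gridDist x y
  gridWalk (i , j) (i′ , j′) with j ≟ᶠ j′
  ... | yes refl = let p , |p| = rowWalk j i i′
                   in  p , trans |p| (sym (trans (cong (∣ toℕ i - toℕ i′ ∣ +_) (∣n-n∣≡0 (toℕ j))) (+-identityʳ _)))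
  ... | no j≢j′  = let p , |p| = rowWalk j′ i i′
                   in  inj₂ (refl , j≢j′) ∷ p ,
                       trans (cong suc |p|) (trans (+-comm 1 _) (cong (∣ toℕ i - toℕ i′ ∣ +_) (sym (j≢j′⇒∣j-j′∣≡1 j≢j′))))

  gridDist-isGraphDistance : IsGraphDistance (PnP2 n) gridDist
  gridDist-isGraphDistance = record
    { dist-refl     = λ (i , j) → cong₂ _+_ (∣n-n∣≡0 (toℕ i)) (∣n-n∣≡0 (toℕ j))
    ; dist-sym      = λ (i , j) (i′ , j′) → cong₂ _+_ (∣-∣-comm (toℕ i) (toℕ i′)) (∣-∣-comm (toℕ j) (toℕ j′))
    ; dist-triangle = gridDist-triangle
    ; dist-adj      = gridDist-adj
    ; shortestWalk  = gridWalk
    }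

module Blocks (d n : ℕ) where
  open Grid {suc n}
  open GraphDistance (PnP2 (suc n)) gridDist-isGraphDistance

  K : ℕ
  K = n / suc d

  block : Vertex → Fin (suc K)
  block (i , _) = fromℕ< (s≤s (/-monoˡ-≤ (suc d) (≤-pred (toℕ<n i))))

  sameBlock⇒gridDist≤ : ∀ x y → block x ≡ block y → gridDist x y ≤ suc d
  sameBlock⇒gridDist≤ (i , j) (i′ , j′) same = begin
    ∣ toℕ i - toℕ i′ ∣ + ∣ toℕ j - toℕ j′ ∣  ≤⟨ +-mono-≤ (≤-pred (m/o≡n/o⇒∣m-n∣<o {toℕ i} {toℕ i′} quotients≡)) (∣j-j′∣≤1 j j′) ⟩
    d + 1                                    ≡⟨ +-comm d 1 ⟩
    suc d                                    ∎
    where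
    open ≤-Reasoning
    quotients≡ : toℕ i / suc d ≡ toℕ i′ / suc d
    quotients≡ = trans (sym (toℕ-fromℕ< _)) (trans (cong toℕ same) (toℕ-fromℕ< _))

  separated⇒length≤ : ∀ {S} → Separated (suc d) S → length S ≤ suc K
  separated⇒length≤ = length≤-if-separated-by block ∘
    AllPairs.map λ {x} {y} far same → <⇒≱ far (sameBlock⇒gridDist≤ x y same)

  row : ℕ → Fin 2
  row zero          = fzero
  row (suc zero)    = fsuc fzero
  row (suc (suc k)) = row k

  row-suc≢row : ∀ k → row (suc k) ≢ row k
  row-suc≢row zero          ()
  row-suc≢row (suc zero)    ()
  row-suc≢row (suc (suc k)) = row-suc≢row k

  column-distance : ∀ a t → ∣ suc d * a - suc d * (a + t) ∣ ≡ suc d * t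
  column-distance a t = trans (cong (∣ suc d * a -_∣) (*-distribˡ-+ (suc d) a t)) (∣m-m+n∣≡n (suc d * a) (suc d * t))

  stairs-apart : ∀ a t → suc d < ∣ suc d * a - suc d * (a + suc t) ∣ + ∣ toℕ (row a) - toℕ (row (a + suc t)) ∣
  stairs-apart a zero = begin-strict
    suc d      <⟨ m<m+n (suc d) z<s ⟩
    suc d + 1  ≡⟨ cong₂ _+_ (trans (column-distance a 1) (*-identityʳ (suc d))) rows-differ ⟨
    ∣ suc d * a - suc d * (a + 1) ∣ + ∣ toℕ (row a) - toℕ (row (a + 1)) ∣ ∎
    where
    open ≤-Reasoning
    rows-differ : ∣ toℕ (row a) - toℕ (row (a + 1)) ∣ ≡ 1
    rows-differ = j≢j′⇒∣j-j′∣≡1 λ eq → row-suc≢row a (sym (trans eq (cong row (+-comm a 1))))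
  stairs-apart a (suc t) = begin-strict
    suc d                                      <⟨ m<m+n (suc d) z<s ⟩
    suc d + suc d * suc t                      ≡⟨ *-suc (suc d) (suc t) ⟨
    suc d * suc (suc t)                        ≡⟨ column-distance a (suc (suc t)) ⟨
    ∣ suc d * a - suc d * (a + suc (suc t)) ∣  ≤⟨ m≤m+n _ _ ⟩
    _                                          ∎
    where open ≤-Reasoning

  stairs-apart-< : ∀ {a b} → a < b → suc d < ∣ suc d * a - suc d * b ∣ + ∣ toℕ (row a) - toℕ (row b) ∣
  stairs-apart-< {a} a<b with m≤n⇒∃[o]m+o≡n a<b
  ... | t , refl = subst (λ b → suc d < ∣ suc d * a - suc d * b ∣ + ∣ toℕ (row a) - toℕ (row b) ∣)
                         (+-suc a t) (stairs-apart a t)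

  column : Fin (suc K) → Fin (suc n)
  column k = fromℕ< (s≤s (begin
    suc d * toℕ k  ≤⟨ *-monoʳ-≤ (suc d) (≤-pred (toℕ<n k)) ⟩
    suc d * K      ≡⟨ *-comm (suc d) K ⟩
    K * suc d      ≤⟨ m/n*n≤m n (suc d) ⟩
    n              ∎))
    where open ≤-Reasoning

  toℕ-column : ∀ k → toℕ (column k) ≡ suc d * toℕ k
  toℕ-column k = toℕ-fromℕ< _

  stair : Fin (suc K) → Vertex
  stair k = column k , row (toℕ k)

  staircase : List Vertex
  staircase = tabulate stair

  length-staircase : length staircase ≡ suc K
  length-staircase = length-tabulate stair

  staircase-separated : Separated (suc d) staircase
  staircase-separated = AllPairs.tabulate⁺-< {f = stair} λ {k} {k′} k<k′ →
    subst (suc d <_)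
      (cong₂ (λ a b → ∣ a - b ∣ + ∣ toℕ (row (toℕ k)) - toℕ (row (toℕ k′)) ∣) (sym (toℕ-column k)) (sym (toℕ-column k′)))
      (stairs-apart-< {toℕ k} {toℕ k′} k<k′)

  ⌈1+n/1+d⌉≡1+K : ⌈ suc n / suc d ⌉ ≡ suc K
  ⌈1+n/1+d⌉≡1+K = begin
    (n + suc d) / suc d          ≡⟨ +-distrib-/-∣ʳ n ∣-refl ⟩
    K + suc d / suc d            ≡⟨ cong (K +_) (n/n≡1 (suc d)) ⟩
    K + 1                        ≡⟨ +-comm K 1 ⟩
    suc K                        ∎
    where open ≡-Reasoning

theorem6p3 : (d n : ℕ) → GpEq (PnP2 (suc n)) 2 (suc d) ⌈ suc n / suc d ⌉
theorem6p3 d n =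
    ( staircase
    , separated⇒unique staircase-separated
    , separated⇒genPos staircase-separated
    , trans length-staircase (sym ⌈1+n/1+d⌉≡1+K) )
  , λ S unique genPos →
      subst (length S ≤_) (sym ⌈1+n/1+d⌉≡1+K) (separated⇒length≤ (genPos⇒separated unique genPos))
  where
  open Blocks d n
  open Grid {suc n}
  open GraphDistance (PnP2 (suc n)) gridDist-isGraphDistance
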